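{- Let $m$ and $n$ be positive integers and let $D$ be a $2$-page drawing of $K_{m,n}$ in which the $m$ blue vertices $b_1,\dots,b_m$ appear on the spine in this order from left to right and no red vertex lies to the left of $b_1$. Let $\sigma,\tau \in \mathrm{Types}(m)$, and suppose $r_\sigma, r_\tau$ are red vertices of $D$ with $\mathrm{type}(r_\sigma)=\sigma$ and $\mathrm{type}(r_\tau)=\tau$. Then \[ \mathrm{cr}_D(\mathrm{st}(r_\sigma), \mathrm{st}(r_\tau)) \ge Q_{\sigma\tau}. \]
   Context: A $2$-page drawing places all vertices on a horizontal line (the spine, the $x$-axis) and draws each edge as a curve in the open upper or open lower half-plane (meeting the spine only at its endpoints). In $K_{m,n}$ the $m$ vertices of degree $n$ are called blue and the $n$ vertices of degree $m$ are called red. The star $\mathrm{st}(r)$ of a red vertex $r$ is the subgraph consisting of $r$ and its $m$ incident edges. For red vertices $r,r'$, $\mathrm{cr}_D(\mathrm{st}(r),\mathrm{st}(r'))$ is the number of crossings in $D$ between an edge of $\mathrm{st}(r)$ and an edge of $\mathrm{st}(r')$. For a red vertex $r$ (with blue vertices $b_1,\dots,b_m$ in left-to-right order and no red vertex left of $b_1$): its position $p(r)$ is the largest $j \in\{1,\dots,m\}$ such that $r$ lies to the right of $b_j$; $U(r)$ is the set of $j$ such that the edge $rb_j$ lies in the upper half-plane and $L(r)=\{1,\dots,m\}\setminus U(r)$. The type of $r$ is $\mathrm{type}(r) = (p(r),U(r),L(r))$, and $\mathrm{Types}(m)$ is the set of all triples $(p,U,L)$ with $p\in\{1,\dots,m\}$,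 $U\subseteq\{1,\dots,m\}$, $L=\{1,\dots,m\}\setminus U$. For $\sigma=(p,U,L)$ and $\tau=(p',U',L')$ in $\mathrm{Types}(m)$, let $[\sigma,\tau]$ be the number of pairs $(i,j)\in\{1,\dots,m\}^2$ such that ($i\in U$ and $j\in U'$, or $i\in L$ and $j\in L'$) and (either $i<j\le p$, or ($j\le p$ and $p'<i$), or ($i<j$ and $p'<i$), or $p<j<i\le p'$). Define $Q_{\sigma\tau} = [\sigma,\tau]$ if $p<p'$, $Q_{\sigma\tau}=[\tau,\sigma]$ if $p>p'$, and $Q_{\sigma\tau}=\min\{[\sigma,\tau],[\tau,\sigma]\}$ if $p=p'$. -}

module Defs where

open import Data.Nat as ℕ using (ℕ; _⊔_; _⊓_)
import Data.Nat.Properties as ℕP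
open import Data.Fin using (Fin; toℕ)
import Data.Fin as F
import Data.Fin.Properties as FP
open import Data.Fin.Subset using (Subset; _∈_; ∁)
open import Data.Fin.Subset.Properties using (_∈?_)
open import Data.List using (List; allFin; map)
open import Data.Nat.ListAction using (sum)
open import Data.Product using (_×_; _,_; proj₁; proj₂)
open import Data.Sum using (_⊎_)
open import Data.Bool using (if_then_else_)
open import Relation.Nullary using (Dec; ¬_; yes; no)
open import Relation.Nullary.Decidable using (⌊_⌋; _×-dec_; _⊎-dec_)
open import Relation.Binary.PropositionalEquality using (_≡_; _≢_)
open import Relation.Binary using (tri<; tri≈; tri>)

countPairs : ∀ {m} (P : Fin m → Fin m → Set) → (∀ i j → Dec (P i j)) → ℕ
countPairs {m} P P? =
  sum (map (λ i → sum (map (λ j → if ⌊ P? i j ⌋ then 1 else 0) (allFin m))) (allFin m))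

-- 2-page drawings of K_{m,n} (combinatorial model).
-- Spine positions are natural numbers (only their order matters).
-- Each edge r b_j lies in the upper or the lower page.

data Page : Set where
  upper lower : Page

record TwoPageDrawing (m n : ℕ) : Set where
  field
    blue : Fin m → ℕ
    red  : Fin n → ℕ
    page : Fin n → Fin m → Page
    red-injective : ∀ r r' → red r ≡ red r' → r ≡ r'
    blue-injective : ∀ i j → blue i ≡ blue j → i ≡ j
    red≢blue : ∀ r j → red r ≢ blue j
open TwoPageDrawing public

BlueInOrder : ∀ {m n} → TwoPageDrawing m n → Set
BlueInOrder D = ∀ i j → i F.< j → blue D i ℕ.< blue D j

NoRedLeftOfFirstBlue : ∀ {m n} → TwoPageDrawing m n → Set
NoRedLeftOfFirstBlue D = ∀ r i → toℕ i ≡ 0 → blue D i ℕ.< red D r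

-- Crossings.  Two edges drawn in the same page, with endpoints {a,b} and
-- {c,d}, cross iff their endpoints strictly interleave along the spine.

StrictlyInside : ℕ → ℕ → ℕ → Set
StrictlyInside x a b = (a ⊓ b ℕ.< x) × (x ℕ.< a ⊔ b)

StrictlyOutside : ℕ → ℕ → ℕ → Set
StrictlyOutside x a b = (x ℕ.< a ⊓ b) ⊎ (a ⊔ b ℕ.< x)

Interleave : ℕ → ℕ → ℕ → ℕ → Set
Interleave a b c d =
  (StrictlyInside c a b × StrictlyOutside d a b) ⊎
  (StrictlyOutside c a b × StrictlyInside d a b)

interleave? : ∀ a b c d → Dec (Interleave a b c d)
interleave? a b c d =
  ((_ ℕ.<? _ ×-dec _ ℕ.<? _) ×-dec (_ ℕ.<? _ ⊎-dec _ ℕ.<? _)) ⊎-dec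
  ((_ ℕ.<? _ ⊎-dec _ ℕ.<? _) ×-dec (_ ℕ.<? _ ×-dec _ ℕ.<? _))

data PageEq : Page → Page → Set where
  uu : PageEq upper upper
  ll : PageEq lower lower

pageEq? : ∀ x y → Dec (PageEq x y)
pageEq? upper upper = yes uu
pageEq? lower lower = yes ll
pageEq? upper lower = no (λ ())
pageEq? lower upper = no (λ ())

EdgesCross : ∀ {m n} → TwoPageDrawing m n → Fin n → Fin n → Fin m → Fin m → Set
EdgesCross D r r' i j =
  PageEq (page D r i) (page D r' j) ×
  Interleave (red D r) (blue D i) (red D r') (blue D j)

crStars : ∀ {m n} → TwoPageDrawing m n → Fin n → Fin n → ℕ
crStars D r r' =
  countPairs (EdgesCross D r r')
    (λ i j → pageEq? (page D r i) (page D r' j)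
             ×-dec interleave? (red D r) (blue D i) (red D r') (blue D j))

-- Types.  Indices are 0-based: Fin m index k stands for b_{k+1}.
-- A type is (p , U); L = ∁ U.

Types : ℕ → Set
Types m = Fin m × Subset m

posT : ∀ {m} → Types m → Fin m
posT = proj₁

UT : ∀ {m} → Types m → Subset m
UT = proj₂

LT : ∀ {m} → Types m → Subset m
LT σ = ∁ (proj₂ σ)

-- type(r) = σ :  p(r) = p  (largest j with r right of b_j),
--                U(r) = U  (j such that r b_j is in the upper page)
HasType : ∀ {m n} → TwoPageDrawing m n → Fin n → Types m → Set
HasType D r σ =
  (blue D (posT σ) ℕ.< red D r) ×
  (∀ j → blue D j ℕ.< red D r → j F.≤ posT σ) ×
  (∀ j → (j ∈ UT σ → page D r j ≡ upper) × (page D r j ≡ upper → j ∈ UT σ))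

BracketPair : ∀ {m} → Types m → Types m → Fin m → Fin m → Set
BracketPair σ τ i j =
  ((i ∈ UT σ × j ∈ UT τ) ⊎ (i ∈ LT σ × j ∈ LT τ)) ×
  ((i F.< j × j F.≤ p) ⊎ (j F.≤ p × p' F.< i) ⊎ (i F.< j × p' F.< i) ⊎
   (p F.< j × j F.< i × i F.≤ p'))
  where p = posT σ ; p' = posT τ

bracket : ∀ {m} → Types m → Types m → ℕ
bracket σ τ = countPairs (BracketPair σ τ) λ i j →
  ((i ∈? UT σ ×-dec j ∈? UT τ) ⊎-dec (i ∈? LT σ ×-dec j ∈? LT τ)) ×-dec
  ((i F.<? j ×-dec j F.≤? posT σ) ⊎-dec (j F.≤? posT σ ×-dec posT τ F.<? i) ⊎-dec
   (i F.<? j ×-dec posT τ F.<? i) ⊎-dec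
   (posT σ F.<? j ×-dec (j F.<? i ×-dec i F.≤? posT τ)))

Q : ∀ {m} → Types m → Types m → ℕ
Q σ τ with FP.<-cmp (posT σ) (posT τ)
... | tri< _ _ _ = bracket σ τ
... | tri≈ _ _ _ = bracket σ τ ⊓ bracket τ σ
... | tri> _ _ _ = bracket τ σ

-- Suppose rσ lies left of rτ.  A pair (i , j) counted by [σ,τ] puts rσ b_i and
-- rτ b_j on a common page (the U/L condition), and each of the four order
-- conditions fixes the spine order of the four endpoints as an interleaving one:
-- i < j ≤ p gives b_i < b_j < rσ < rτ, while j ≤ p and p' < i give
-- b_j < rσ < rτ < b_i, and so on.  Hence [σ,τ] counts a subset of the crossing
-- pairs of the two stars, in either orientation.  If p < p' then rσ < b_p' < rτ;
-- if p = p' the spine order of rσ, rτ decides which bracket bounds the crossings,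
-- and either one dominates the minimum.
module Submission where

open import Defs
open import Data.Nat using (ℕ; _<_; _≤_)
open import Data.Fin using (Fin)
open import Relation.Binary.PropositionalEquality using (_≢_)
open import Data.Nat using (zero; suc; _+_; z≤n)
import Data.Nat.Properties as NP
import Data.Fin as F
import Data.Fin.Properties as FP
open import Data.Fin.Subset using (_∈_)
open import Data.Fin.Subset.Properties using (x∈∁p⇒x∉p)
open import Data.List using (List; []; _∷_; allFin; map; tabulate)
open import Data.List.Properties using (map-tabulate)
open import Data.Nat.ListAction using (sum)
open import Data.Product using (_×_; _,_; proj₁; proj₂)
open import Data.Sum using (_⊎_; inj₁; inj₂)
open import Data.Bool using (if_then_else_)
open import Data.Empty using (⊥-elim)
open import Function using (_∘_)
open import Relation.Nullary using (Dec; yes; no)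
open import Relation.Nullary.Decidable using (⌊_⌋)
open import Relation.Binary.PropositionalEquality
  using (_≡_; refl; sym; trans; cong; subst; module ≡-Reasoning)
open import Relation.Binary using (tri<; tri≈; tri>)
open import Algebra.Properties.CommutativeMonoid.Sum NP.+-0-commutativeMonoid
  using (∑-comm; sum-cong-≋) renaming (sum to ∑)

sum-mono : ∀ {A : Set} {f g : A → ℕ} → (∀ x → f x ≤ g x) → (xs : List A) →
  sum (map f xs) ≤ sum (map g xs)
sum-mono f≤g []       = NP.≤-refl
sum-mono f≤g (x ∷ xs) = NP.+-mono-≤ (f≤g x) (sum-mono f≤g xs)

sum-tabulate : ∀ {m} (f : Fin m → ℕ) → sum (tabulate f) ≡ ∑ f
sum-tabulate {zero}  f = refl
sum-tabulate {suc m} f = cong (f F.zero +_) (sum-tabulate (f ∘ F.suc))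

sum-allFin : ∀ {m} (f : Fin m → ℕ) → sum (map f (allFin m)) ≡ ∑ f
sum-allFin f = trans (cong sum (map-tabulate (λ i → i) f)) (sum-tabulate f)

indicator : ∀ {P : Set} → Dec P → ℕ
indicator P? = if ⌊ P? ⌋ then 1 else 0

module _ {m : ℕ} where

  countPairs≡∑∑ : (P : Fin m → Fin m → Set) (P? : ∀ i j → Dec (P i j)) →
    countPairs P P? ≡ ∑ (λ i → ∑ (λ j → indicator (P? i j)))
  countPairs≡∑∑ P P? =
    trans (sum-allFin (λ i → sum (map (λ j → indicator (P? i j)) (allFin m))))
          (sum-cong-≋ (λ i → sum-allFin (λ j → indicator (P? i j))))

  countPairs-transpose : (P : Fin m → Fin m → Set) (P? : ∀ i j → Dec (P i j)) →
    countPairs (λ i j → P j i) (λ i j → P? j i) ≡ countPairs P P?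
  countPairs-transpose P P? = begin
    countPairs (λ i j → P j i) (λ i j → P? j i)
      ≡⟨ countPairs≡∑∑ _ _ ⟩
    ∑ (λ i → ∑ (λ j → indicator (P? j i)))
      ≡⟨ ∑-comm (λ i j → indicator (P? j i)) ⟩
    ∑ (λ j → ∑ (λ i → indicator (P? j i)))
      ≡⟨ sym (countPairs≡∑∑ P P?) ⟩
    countPairs P P? ∎
    where open ≡-Reasoning

  countPairs-mono : {P R : Fin m → Fin m → Set}
    (P? : ∀ i j → Dec (P i j)) (R? : ∀ i j → Dec (R i j)) →
    (∀ i j → P i j → R i j) → countPairs P P? ≤ countPairs R R?
  countPairs-mono P? R? P⇒R =
    sum-mono (λ i → sum-mono (indicator-mono i) (allFin m)) (allFin m)
    where
    indicator-mono : ∀ i j → indicator (P? i j) ≤ indicator (R? i j)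
    indicator-mono i j with P? i j | R? i j
    ... | no _  | _     = z≤n
    ... | yes _ | yes _ = NP.≤-refl
    ... | yes p | no ¬r = ⊥-elim (¬r (P⇒R i j p))

  countPairs-mono-transpose : {P R : Fin m → Fin m → Set}
    (P? : ∀ i j → Dec (P i j)) (R? : ∀ i j → Dec (R i j)) →
    (∀ i j → P i j → R j i) → countPairs P P? ≤ countPairs R R?
  countPairs-mono-transpose {R = R} P? R? P⇒Rᵀ =
    NP.≤-trans (countPairs-mono P? (λ i j → R? j i) P⇒Rᵀ)
               (NP.≤-reflexive (countPairs-transpose R R?))

between⇒inside : ∀ {a x b} → a < x → x < b → StrictlyInside x a b
between⇒inside {a} {x} {b} a<x x<b =
  NP.≤-<-trans (NP.m⊓n≤m a b) a<x , NP.<-≤-trans x<b (NP.m≤n⊔m a b)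

inside-comm : ∀ {x a b} → StrictlyInside x a b → StrictlyInside x b a
inside-comm {x} {a} {b} (l , u) =
  subst (_< x) (NP.⊓-comm a b) l , subst (x <_) (NP.⊔-comm a b) u

outside-comm : ∀ {x a b} → StrictlyOutside x a b → StrictlyOutside x b a
outside-comm {x} {a} {b} (inj₁ l) = inj₁ (subst (x <_) (NP.⊓-comm a b) l)
outside-comm {x} {a} {b} (inj₂ u) = inj₂ (subst (_< x) (NP.⊔-comm a b) u)

interleave-swapˡ : ∀ {a b c d} → Interleave a b c d → Interleave b a c d
interleave-swapˡ (inj₁ (c∈ , d∉)) = inj₁ (inside-comm c∈ , outside-comm d∉)
interleave-swapˡ (inj₂ (c∉ , d∈)) = inj₂ (outside-comm c∉ , inside-comm d∈)

interleave-swapʳ : ∀ {a b c d} → Interleave a b c d → Interleave a b d c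
interleave-swapʳ (inj₁ (c∈ , d∉)) = inj₂ (d∉ , c∈)
interleave-swapʳ (inj₂ (c∉ , d∈)) = inj₁ (d∈ , c∉)

w<x<y<z⇒interleave : ∀ {w x y z} → w < x → x < y → y < z →
  Interleave w y x z × Interleave x z w y
w<x<y<z⇒interleave w<x x<y y<z =
  inj₁ (between⇒inside w<x x<y , inj₂ (NP.⊔-pres-<m w<z y<z)) ,
  inj₂ (inj₁ (NP.⊓-pres-m< w<x w<z) , between⇒inside x<y y<z)
  where
  w<z = NP.<-trans w<x (NP.<-trans x<y y<z)

pageEq-sym : ∀ {a b} → PageEq a b → PageEq b a
pageEq-sym uu = uu
pageEq-sym ll = ll

module _ {m n : ℕ} (D : TwoPageDrawing m n) where

  HasType⇒red<blue : ∀ {r σ j} → HasType D r σ → posT σ F.< j → red D r < blue D j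
  HasType⇒red<blue {r} {j = j} (_ , rightmost , _) p<j
    with NP.<-cmp (blue D j) (red D r)
  ... | tri< b<r _ _ = ⊥-elim (NP.<⇒≱ p<j (rightmost j b<r))
  ... | tri≈ _ b≡r _ = ⊥-elim (red≢blue D r j (sym b≡r))
  ... | tri> _ _ r<b = r<b

  HasType⇒upper : ∀ {r σ j} → HasType D r σ → j ∈ UT σ → page D r j ≡ upper
  HasType⇒upper {j = j} (_ , _ , pages) j∈U = proj₁ (pages j) j∈U

  HasType⇒lower : ∀ {r σ j} → HasType D r σ → j ∈ LT σ → page D r j ≡ lower
  HasType⇒lower {r} {j = j} (_ , _ , pages) j∈L with page D r j in eq
  ... | lower = refl
  ... | upper = ⊥-elim (x∈∁p⇒x∉p j∈L (proj₂ (pages j) eq))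

  HasType⇒samePage : ∀ {r r' σ τ i j} → HasType D r σ → HasType D r' τ →
    (i ∈ UT σ × j ∈ UT τ) ⊎ (i ∈ LT σ × j ∈ LT τ) →
    PageEq (page D r i) (page D r' j)
  HasType⇒samePage hσ hτ (inj₁ (i∈U , j∈U'))
    rewrite HasType⇒upper hσ i∈U | HasType⇒upper hτ j∈U' = uu
  HasType⇒samePage hσ hτ (inj₂ (i∈L , j∈L'))
    rewrite HasType⇒lower hσ i∈L | HasType⇒lower hτ j∈L' = ll

  pos<⇒red< : ∀ {r r' σ τ} → HasType D r σ → HasType D r' τ →
    posT σ F.< posT τ → red D r < red D r'
  pos<⇒red< hσ (b<r' , _) p<p' = NP.<-trans (HasType⇒red<blue hσ p<p') b<r'

  module _ (ordered : BlueInOrder D) where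

    HasType⇒blue<red : ∀ {r σ j} → HasType D r σ → j F.≤ posT σ → blue D j < red D r
    HasType⇒blue<red {r} {σ} {j} (b<r , _) j≤p with NP.m≤n⇒m<n∨m≡n j≤p
    ... | inj₁ j<p = NP.<-trans (ordered j (posT σ) j<p) b<r
    ... | inj₂ j≡p = subst (λ k → blue D k < red D r) (sym (FP.toℕ-injective j≡p)) b<r

    bracketPair⇒interleave : ∀ {r r' σ τ i j} → HasType D r σ → HasType D r' τ →
      red D r < red D r' → BracketPair σ τ i j →
      Interleave (red D r) (blue D i) (red D r') (blue D j) ×
      Interleave (red D r') (blue D j) (red D r) (blue D i)
    bracketPair⇒interleave {i = i} {j} hσ hτ r<r' (_ , inj₁ (i<j , j≤p)) =
      let c , c' = w<x<y<z⇒interleave (ordered i j i<j) (HasType⇒blue<red hσ j≤p) r<r' in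
      interleave-swapˡ (interleave-swapʳ c) , interleave-swapˡ (interleave-swapʳ c')
    bracketPair⇒interleave hσ hτ r<r' (_ , inj₂ (inj₁ (j≤p , p'<i))) =
      let c , c' = w<x<y<z⇒interleave (HasType⇒blue<red hσ j≤p) r<r'
                                      (HasType⇒red<blue hτ p'<i) in
      interleave-swapʳ c' , interleave-swapˡ c
    bracketPair⇒interleave {i = i} {j} hσ hτ r<r' (_ , inj₂ (inj₂ (inj₁ (i<j , p'<i)))) =
      w<x<y<z⇒interleave r<r' (HasType⇒red<blue hτ p'<i) (ordered i j i<j)
    bracketPair⇒interleave {i = i} {j} hσ hτ r<r'
      (_ , inj₂ (inj₂ (inj₂ (p<j , j<i , i≤p')))) =
      let c , c' = w<x<y<z⇒interleave (HasType⇒red<blue hσ p<j) (ordered j i j<i)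
                                      (HasType⇒blue<red hτ i≤p') in
      interleave-swapʳ c , interleave-swapˡ c'

    bracketPair⇒edgesCross : ∀ {r r' σ τ i j} → HasType D r σ → HasType D r' τ →
      red D r < red D r' → BracketPair σ τ i j →
      EdgesCross D r r' i j × EdgesCross D r' r j i
    bracketPair⇒edgesCross hσ hτ r<r' pair@(sameSide , _) =
      let same = HasType⇒samePage hσ hτ sameSide
          cross , cross' = bracketPair⇒interleave hσ hτ r<r' pair in
      (same , cross) , (pageEq-sym same , cross')

    bracket≤crStars : ∀ {r r' σ τ} → HasType D r σ → HasType D r' τ →
      red D r < red D r' →
      bracket σ τ ≤ crStars D r r' × bracket σ τ ≤ crStars D r' r
    bracket≤crStars {r} {r'} {σ} {τ} hσ hτ r<r' =
      countPairs-mono {m = m} _ _ (λ _ _ → proj₁ ∘ cross) ,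
      countPairs-mono-transpose {m = m} _ _ (λ _ _ → proj₂ ∘ cross)
      where
      cross : ∀ {i j} → BracketPair σ τ i j → EdgesCross D r r' i j × EdgesCross D r' r j i
      cross = bracketPair⇒edgesCross hσ hτ r<r'

proposition1 : (m n : ℕ) → 0 < m → 0 < n →
    (D : TwoPageDrawing m n) → BlueInOrder D → NoRedLeftOfFirstBlue D →
    (σ τ : Types m) (rσ rτ : Fin n) → rσ ≢ rτ →
    HasType D rσ σ → HasType D rτ τ →
    Q σ τ ≤ crStars D rσ rτ
proposition1 m n _ _ D ordered _ σ τ rσ rτ rσ≢rτ hσ hτ with FP.<-cmp (posT σ) (posT τ)
... | tri< p<p' _ _ = proj₁ (bracket≤crStars D ordered hσ hτ (pos<⇒red< D hσ hτ p<p'))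
... | tri> _ _ p'<p = proj₂ (bracket≤crStars D ordered hτ hσ (pos<⇒red< D hτ hσ p'<p))
... | tri≈ _ _ _ with NP.<-cmp (red D rσ) (red D rτ)
...   | tri< rσ<rτ _ _ =
        NP.≤-trans (NP.m⊓n≤m _ _) (proj₁ (bracket≤crStars D ordered hσ hτ rσ<rτ))
...   | tri≈ _ rσ≡rτ _ = ⊥-elim (rσ≢rτ (red-injective D rσ rτ rσ≡rτ))
...   | tri> _ _ rτ<rσ =
        NP.≤-trans (NP.m⊓n≤n _ _) (proj₂ (bracket≤crStars D ordered hτ hσ rτ<rσ))
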